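{- For all integers $r,s\ge 2$, $\mathrm{mob}(K_r\,\square\, P_s) = r$.
   Context: $K_r$ is the complete graph on $r$ vertices and $P_s$ the path on $s$ vertices; $\square$ denotes the Cartesian product (vertex set $V(G)\times V(H)$, $(g,h)\sim(g',h')$ iff ($gg'\in E(G)$, $h=h'$) or ($g=g'$, $hh'\in E(H)$)). A set $S\subseteq V(G)$ is a general position set if no three vertices of $S$ lie on a common shortest path. Robots are placed one per vertex of a general position set $S$; a move $u\to v$ along an edge $uv$ with $u\in S$ is legal if $v\notin S$ and $(S\setminus\{u\})\cup\{v\}$ is a general position set. $S$ is a mobile general position set if some sequence of legal moves starting from $S$ visits every vertex of the graph at least once; $\mathrm{mob}(G)$ is the maximum size of a mobile general position set. -}

module Defs where

open import Level using (0ℓ)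
open import Data.Nat using (ℕ; zero; suc; _≤_)
open import Data.Fin using (Fin; toℕ)
open import Data.Product using (_×_; _,_; Σ; ∃; ∃-syntax)
open import Data.Sum using (_⊎_)
open import Data.Empty using (⊥)
open import Data.List using (List; []; _∷_; length)
open import Data.List.Membership.Propositional using (_∈_; _∉_)
open import Data.List.Relation.Unary.Any using (Any)
open import Data.List.Relation.Unary.Linked using (Linked)
open import Data.List.Relation.Unary.Unique.Propositional using (Unique)
open import Relation.Nullary using (¬_)
open import Relation.Binary.PropositionalEquality using (_≡_; _≢_)
open import Function.Bundles using (_⇔_)

record Graph : Set₁ where
  field
    V : Set
    E : V → V → Set

module _ (G : Graph) where
  open Graph G

  data Walk : V → V → ℕ → Set where
    []  : ∀ {a} → Walk a a 0
    _∷_ : ∀ {a b c n} → E a b → Walk b c n → Walk a c (suc n)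

  data OnWalk (x : V) : ∀ {a b n} → Walk a b n → Set where
    here  : ∀ {b n} {w : Walk x b n} → OnWalk x w
    there : ∀ {a a' b n} {e : E a a'} {w : Walk a' b n} → OnWalk x w → OnWalk x (e ∷ w)

  IsShortest : ∀ {a b n} → Walk a b n → Set
  IsShortest {a} {b} {n} _ = ∀ m → Walk a b m → n ≤ m

  OnCommonGeodesic : V → V → V → Set
  OnCommonGeodesic x y z =
    ∃[ a ] ∃[ b ] ∃[ n ] Σ (Walk a b n) λ w →
      IsShortest w × OnWalk x w × OnWalk y w × OnWalk z w

  IsGP : List V → Set
  IsGP S = ∀ x y z → x ∈ S → y ∈ S → z ∈ S →
    x ≢ y → y ≢ z → x ≢ z → ¬ OnCommonGeodesic x y z

  LegalMove : List V → List V → Set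
  LegalMove S S' = ∃[ u ] ∃[ v ]
    E u v × u ∈ S × v ∉ S ×
    (∀ x → (x ∈ S' ⇔ ((x ∈ S × x ≢ u) ⊎ x ≡ v))) ×
    IsGP S'

  IsMobileGP : List V → Set
  IsMobileGP S = IsGP S × ∃[ rest ]
    (Linked LegalMove (S ∷ rest) × (∀ v → Any (v ∈_) (S ∷ rest)))

  MobEq : ℕ → Set
  MobEq k =
    (∃[ S ] (Unique S × IsMobileGP S × length S ≡ k)) ×
    (∀ S → Unique S → IsMobileGP S → length S ≤ k)

K : ℕ → Graph
K r = record { V = Fin r ; E = λ i j → i ≢ j }

P : ℕ → Graph
P s = record { V = Fin s ; E = λ i j → (toℕ j ≡ suc (toℕ i)) ⊎ (toℕ i ≡ suc (toℕ j)) }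

_□_ : Graph → Graph → Graph
G □ H = record
  { V = Graph.V G × Graph.V H
  ; E = λ { (g , h) (g' , h') → (Graph.E G g g' × h ≡ h') ⊎ (g ≡ g' × Graph.E H h h') }
  }

{-# OPTIONS --safe #-}

-- The distance in K_r □ P_s from (a , j) to (b , l) is [a ≠ b] + |j − l|, so every vertex of a
-- shortest path lies in the column (copy of P_s) of one of its ends.  Hence one robot per column is
-- in general position whatever the heights, and moving one robot at a time up or down its column
-- and back, the robots visit every vertex: mob ≥ r.
-- Conversely, among r + 1 robots in general position some column holds two, at heights p < q, and
-- then every other robot lies in another column strictly between heights p and q.  A legal move
-- never takes a robot out of this doubled column, since the column it enters would then have to be
-- doubled as well, violating these constraints before or after the move.  So the bottom vertex of
-- any other column is never visited: mob ≤ r.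

module Submission where

open import Defs
open import Data.Empty using (⊥; ⊥-elim)
open import Data.Fin using (Fin; zero; suc; toℕ; fromℕ<; inject≤; punchIn)
open import Data.Fin.Properties as Fin using (punchInᵢ≢i; pigeonhole; toℕ-injective; toℕ-fromℕ<; inject≤-injective)
open import Data.List using (List; []; _∷_; length; lookup; tabulate; allFin; cartesianProduct)
open import Data.List.Membership.Propositional using (_∈_; _∉_)
open import Data.List.Membership.Propositional.Properties
  using (∈-lookup; ∈-tabulate⁺; ∈-tabulate⁻; ∈-allFin; ∈-cartesianProduct⁺)
open import Data.List.Properties using (tabulate-cong; length-tabulate)
open import Data.List.Relation.Unary.All as All using (All; []; _∷_)
open import Data.List.Relation.Unary.Any using (Any; here; there)
open import Data.List.Relation.Unary.AllPairs using (_∷_)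
open import Data.List.Relation.Unary.Linked using (Linked; [-]; _∷_)
open import Data.List.Relation.Unary.Unique.Propositional using (Unique)
import Data.List.Relation.Unary.Unique.Propositional.Properties as Unique
open import Data.Nat using (ℕ; zero; suc; _+_; _≤_; _<_; z≤n; s≤s; ∣_-_∣)
open import Data.Nat.Properties
open import Algebra.Properties.CommutativeSemigroup +-commutativeSemigroup using (interchange)
open import Data.Product using (_×_; _,_; Σ; ∃-syntax; proj₁; proj₂)
open import Data.Product.Properties using (≡-dec; ,-injectiveˡ; ,-injectiveʳ)
open import Data.Sum as Sum using (_⊎_; inj₁; inj₂)
open import Data.Vec.Functional using (updateAt)
open import Data.Vec.Functional.Properties using (updateAt-updates; updateAt-minimal)
open import Function using (_∘_; const)
open import Function.Bundles using (_⇔_; mk⇔; Equivalence)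
open import Relation.Binary.Construct.Closure.ReflexiveTransitive using (Star; ε; _◅_; _◅◅_)
open import Relation.Binary.Definitions using (DecidableEquality; tri<; tri≈; tri>)
open import Relation.Binary.PropositionalEquality using (_≡_; _≢_; refl; sym; trans; cong; cong₂; subst)
open import Relation.Nullary using (¬_; yes; no; contradiction)

module _ {G : Graph} where
  open Graph G

  _++ʷ_ : ∀ {a b c m n} → Walk G a b m → Walk G b c n → Walk G a c (m + n)
  [] ++ʷ w = w
  (e ∷ v) ++ʷ w = e ∷ (v ++ʷ w)

  _∷ʳ_ : ∀ {a b c n} → Walk G a b n → E b c → Walk G a c (suc n)
  [] ∷ʳ e = e ∷ []
  (e′ ∷ w) ∷ʳ e = e′ ∷ (w ∷ʳ e)

  onWalk-end : ∀ {a b n} (w : Walk G a b n) → OnWalk G b w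
  onWalk-end [] = here
  onWalk-end (e ∷ w) = there (onWalk-end w)

  onWalk-++ʳ : ∀ {x a b c m n} (v : Walk G a b m) {w : Walk G b c n} →
               OnWalk G x w → OnWalk G x (v ++ʷ w)
  onWalk-++ʳ [] x∈w = x∈w
  onWalk-++ʳ (e ∷ v) x∈w = there (onWalk-++ʳ v x∈w)

  splitAt : ∀ {x a b n} {w : Walk G a b n} → OnWalk G x w →
            ∃[ i ] ∃[ j ] Walk G a x i × Walk G x b j × i + j ≡ n
  splitAt {w = w} here = 0 , _ , [] , w , refl
  splitAt {w = e ∷ w} (there x∈w) with splitAt x∈w
  ... | i , j , u , v , i+j≡n = suc i , j , e ∷ u , v , cong suc i+j≡n

mapʷ : ∀ {G H : Graph} (f : Graph.V G → Graph.V H) →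
       (∀ {x y} → Graph.E G x y → Graph.E H (f x) (f y)) →
       ∀ {a b n} → Walk G a b n → Walk H (f a) (f b) n
mapʷ f f-edge [] = []
mapʷ f f-edge (e ∷ w) = f-edge e ∷ mapʷ f f-edge w

Between : {A : Set} → (A → A → ℕ) → A → A → A → Set
Between d x y z = d x y + d y z ≤ d x z

record IsDistance (G : Graph) (d : Graph.V G → Graph.V G → ℕ) : Set where
  field
    ≤-length : ∀ {x y n} → Walk G x y n → d x y ≤ n
    geodesic : ∀ x y → Walk G x y (d x y)

  triangle : ∀ x y z → d x z ≤ d x y + d y z
  triangle x y z = ≤-length (geodesic x y ++ʷ geodesic y z)

  between⇒onCommonGeodesic : ∀ {x y z} → Between d x y z → OnCommonGeodesic G x y z
  between⇒onCommonGeodesic {x} {y} {z} xyz =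
    x , z , _ , γ , (λ m w → ≤-trans xyz (≤-length w)) ,
    here , onWalk-++ʳ (geodesic x y) here , onWalk-++ʳ (geodesic x y) (onWalk-end (geodesic y z))
    where
    γ : Walk G x z (d x y + d y z)
    γ = geodesic x y ++ʷ geodesic y z

  onShortest⇒between : ∀ {a b x n} {w : Walk G a b n} →
                       IsShortest G w → OnWalk G x w → Between d a x b
  onShortest⇒between {a} {b} shortest x∈w with splitAt x∈w
  ... | i , j , u , v , refl =
    ≤-trans (+-mono-≤ (≤-length u) (≤-length v)) (shortest _ (geodesic a b))

_⊗_ : {A B : Set} → (A → A → ℕ) → (B → B → ℕ) → A × B → A × B → ℕ
(d₁ ⊗ d₂) (a , b) (a′ , b′) = d₁ a a′ + d₂ b b′

module _ {G H : Graph} where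

  □-project : ∀ {x y n} → Walk (G □ H) x y n →
    ∃[ m ] ∃[ k ] Walk G (proj₁ x) (proj₁ y) m × Walk H (proj₂ x) (proj₂ y) k × m + k ≡ n
  □-project [] = 0 , 0 , [] , [] , refl
  □-project (inj₁ (e , refl) ∷ w) with □-project w
  ... | m , k , u , v , m+k≡n = suc m , k , e ∷ u , v , cong suc m+k≡n
  □-project (inj₂ (refl , e) ∷ w) with □-project w
  ... | m , k , u , v , m+k≡n = m , suc k , u , e ∷ v , trans (+-suc m k) (cong suc m+k≡n)

  □-isDistance : ∀ {d₁ d₂} → IsDistance G d₁ → IsDistance H d₂ → IsDistance (G □ H) (d₁ ⊗ d₂)
  □-isDistance {d₁} {d₂} D₁ D₂ = record { ≤-length = ≤-length ; geodesic = geodesic }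
    where
    module D₁ = IsDistance D₁
    module D₂ = IsDistance D₂

    ≤-length : ∀ {x y n} → Walk (G □ H) x y n → (d₁ ⊗ d₂) x y ≤ n
    ≤-length w with □-project w
    ... | m , k , u , v , refl = +-mono-≤ (D₁.≤-length u) (D₂.≤-length v)

    geodesic : ∀ x y → Walk (G □ H) x y ((d₁ ⊗ d₂) x y)
    geodesic (g , h) (g′ , h′) =
      mapʷ (_, h) (λ e → inj₁ (e , refl)) (D₁.geodesic g g′) ++ʷ
      mapʷ (g′ ,_) (λ e → inj₂ (refl , e)) (D₂.geodesic h h′)

module _ {A B : Set} {d₁ : A → A → ℕ} {d₂ : B → B → ℕ} where

  between-⊗ : ∀ {x y z : A × B} → Between d₁ (proj₁ x) (proj₁ y) (proj₁ z) →
              Between d₂ (proj₂ x) (proj₂ y) (proj₂ z) → Between (d₁ ⊗ d₂) x y z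
  between-⊗ {a , b} {a′ , b′} {a″ , b″} p q =
    ≤-trans (≤-reflexive (interchange (d₁ a a′) (d₂ b b′) (d₁ a′ a″) (d₂ b′ b″))) (+-mono-≤ p q)

  between-proj₁ : (∀ b b′ b″ → d₂ b b″ ≤ d₂ b b′ + d₂ b′ b″) →
                  ∀ {x y z : A × B} → Between (d₁ ⊗ d₂) x y z →
                  Between d₁ (proj₁ x) (proj₁ y) (proj₁ z)
  between-proj₁ triangle₂ {a , b} {a′ , b′} {a″ , b″} p =
    +-cancelʳ-≤ (d₂ b b′ + d₂ b′ b″) (d₁ a a′ + d₁ a′ a″) (d₁ a a″) (begin
      (d₁ a a′ + d₁ a′ a″) + (d₂ b b′ + d₂ b′ b″) ≡⟨ interchange (d₁ a a′) (d₁ a′ a″) (d₂ b b′) (d₂ b′ b″) ⟩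
      (d₁ a a′ + d₂ b b′) + (d₁ a′ a″ + d₂ b′ b″) ≤⟨ p ⟩
      d₁ a a″ + d₂ b b″                           ≤⟨ +-monoʳ-≤ (d₁ a a″) (triangle₂ b b′ b″) ⟩
      d₁ a a″ + (d₂ b b′ + d₂ b′ b″)              ∎)
    where open ≤-Reasoning

dK : ∀ {r} → Fin r → Fin r → ℕ
dK a b with a Fin.≟ b
... | yes _ = 0
... | no _ = 1

dK-refl : ∀ {r} (a : Fin r) → dK a a ≡ 0
dK-refl a with a Fin.≟ a
... | yes _ = refl
... | no a≢a = contradiction refl a≢a

dK-≢ : ∀ {r} {a b : Fin r} → a ≢ b → dK a b ≡ 1
dK-≢ {a = a} {b} a≢b with a Fin.≟ b
... | yes a≡b = contradiction a≡b a≢b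
... | no _ = refl

dK≤1 : ∀ {r} (a b : Fin r) → dK a b ≤ 1
dK≤1 a b with a Fin.≟ b
... | yes _ = z≤n
... | no _ = s≤s z≤n

K-isDistance : ∀ r → IsDistance (K r) dK
K-isDistance r = record { ≤-length = ≤-length ; geodesic = geodesic }
  where
  ≤-length : ∀ {a b n} → Walk (K r) a b n → dK a b ≤ n
  ≤-length {a} [] = ≤-reflexive (dK-refl a)
  ≤-length {a} {b} (_ ∷ _) = ≤-trans (dK≤1 a b) (s≤s z≤n)

  geodesic : ∀ a b → Walk (K r) a b (dK a b)
  geodesic a b with a Fin.≟ b
  ... | yes refl = []
  ... | no a≢b = a≢b ∷ []

K-between-left : ∀ {r} (a b : Fin r) → Between dK a a b
K-between-left a b rewrite dK-refl a = ≤-refl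

K-between-right : ∀ {r} (a b : Fin r) → Between dK a b b
K-between-right a b rewrite dK-refl b | +-identityʳ (dK a b) = ≤-refl

K-between⇒endpoint : ∀ {r} {a x b : Fin r} → Between dK a x b → x ≡ a ⊎ x ≡ b
-- Deciding x ≟ a and b ≟ x (not a ≟ x and x ≟ b) keeps `with` from abstracting dK a x and dK x b
-- in the type of axb.
K-between⇒endpoint {a = a} {x} {b} axb with x Fin.≟ a | b Fin.≟ x
... | yes x≡a | _ = inj₁ x≡a
... | no _ | yes b≡x = inj₂ (sym b≡x)
... | no x≢a | no b≢x = contradiction (≤-trans 2≤ (≤-trans axb (dK≤1 a b))) 1+n≰n
  where
  2≤ : 2 ≤ dK a x + dK x b
  2≤ = ≤-reflexive (sym (cong₂ _+_ (dK-≢ (x≢a ∘ sym)) (dK-≢ (b≢x ∘ sym))))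

dP : ∀ {s} → Fin s → Fin s → ℕ
dP j l = ∣ toℕ j - toℕ l ∣

P-edge⇒dP≡1 : ∀ {s} {j l : Fin s} → Graph.E (P s) j l → dP j l ≡ 1
P-edge⇒dP≡1 {j = j} (inj₁ l≡1+j) = trans (cong (∣ toℕ j -_∣) l≡1+j) (∣n-1+n∣≡1 (toℕ j))
  where
  ∣n-1+n∣≡1 : ∀ n → ∣ n - suc n ∣ ≡ 1
  ∣n-1+n∣≡1 n = trans (m≤n⇒∣m-n∣≡n∸m (n≤1+n n)) (m+n∸n≡m 1 n)
P-edge⇒dP≡1 {j = j} {l} (inj₂ j≡1+l) = trans (∣-∣-comm (toℕ j) (toℕ l)) (P-edge⇒dP≡1 (inj₁ j≡1+l))

P-edge⇒≢ : ∀ {s} {j l : Fin s} → Graph.E (P s) j l → j ≢ l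
P-edge⇒≢ {j = j} e refl = 0≢1+n (trans (sym (∣n-n∣≡0 (toℕ j))) (P-edge⇒dP≡1 e))

P-shift : ∀ {s} {j l : Fin s} → Graph.E (P s) j l → Graph.E (P (suc s)) (suc j) (suc l)
P-shift = Sum.map (cong suc) (cong suc)

P-geodesic : ∀ {s} (j l : Fin s) → Walk (P s) j l (dP j l)
P-geodesic zero zero = []
P-geodesic zero (suc zero) = inj₁ refl ∷ []
P-geodesic zero (suc (suc l)) = inj₁ refl ∷ mapʷ suc P-shift (P-geodesic zero (suc l))
P-geodesic (suc zero) zero = inj₂ refl ∷ []
P-geodesic (suc (suc j)) zero = mapʷ suc P-shift (P-geodesic (suc j) zero) ∷ʳ inj₂ refl
P-geodesic (suc j) (suc l) = mapʷ suc P-shift (P-geodesic j l)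

P-isDistance : ∀ s → IsDistance (P s) dP
P-isDistance s = record { ≤-length = ≤-length ; geodesic = P-geodesic }
  where
  ≤-length : ∀ {j l n} → Walk (P s) j l n → dP j l ≤ n
  ≤-length {j} [] = ≤-reflexive (∣n-n∣≡0 (toℕ j))
  ≤-length {j} {l} {suc n} (_∷_ {b = k} e w) = begin
    ∣ toℕ j - toℕ l ∣                   ≤⟨ ∣-∣-triangle (toℕ j) (toℕ k) (toℕ l) ⟩
    ∣ toℕ j - toℕ k ∣ + ∣ toℕ k - toℕ l ∣ ≡⟨ cong (_+ dP k l) (P-edge⇒dP≡1 e) ⟩
    suc (dP k l)                        ≤⟨ s≤s (≤-length w) ⟩
    suc n                               ∎
    where open ≤-Reasoning

m≤n≤o⇒∣m-n∣+∣n-o∣≡∣m-o∣ : ∀ {m n o} → m ≤ n → n ≤ o → ∣ m - n ∣ + ∣ n - o ∣ ≡ ∣ m - o ∣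
m≤n≤o⇒∣m-n∣+∣n-o∣≡∣m-o∣ {n = zero} z≤n _ = refl
m≤n≤o⇒∣m-n∣+∣n-o∣≡∣m-o∣ {n = suc _} z≤n (s≤s n≤o) = cong suc (m≤n≤o⇒∣m-n∣+∣n-o∣≡∣m-o∣ z≤n n≤o)
m≤n≤o⇒∣m-n∣+∣n-o∣≡∣m-o∣ (s≤s m≤n) (s≤s n≤o) = m≤n≤o⇒∣m-n∣+∣n-o∣≡∣m-o∣ m≤n n≤o

P-between : ∀ {s} {j k l : Fin s} → toℕ j ≤ toℕ k → toℕ k ≤ toℕ l → Between dP j k l
P-between j≤k k≤l = ≤-reflexive (m≤n≤o⇒∣m-n∣+∣n-o∣≡∣m-o∣ j≤k k≤l)

three-distinct-among-two : ∀ {A : Set} {a b x y z : A} →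
  x ≡ a ⊎ x ≡ b → y ≡ a ⊎ y ≡ b → z ≡ a ⊎ z ≡ b → x ≢ y → y ≢ z → x ≢ z → ⊥
three-distinct-among-two (inj₁ x≡a) (inj₁ y≡a) _ x≢y _ _ = x≢y (trans x≡a (sym y≡a))
three-distinct-among-two (inj₂ x≡b) (inj₂ y≡b) _ x≢y _ _ = x≢y (trans x≡b (sym y≡b))
three-distinct-among-two (inj₁ x≡a) (inj₂ _) (inj₁ z≡a) _ _ x≢z = x≢z (trans x≡a (sym z≡a))
three-distinct-among-two (inj₁ _) (inj₂ y≡b) (inj₂ z≡b) _ y≢z _ = y≢z (trans y≡b (sym z≡b))
three-distinct-among-two (inj₂ _) (inj₁ y≡a) (inj₁ z≡a) _ y≢z _ = y≢z (trans y≡a (sym z≡a))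
three-distinct-among-two (inj₂ x≡b) (inj₁ _) (inj₂ z≡b) _ _ x≢z = x≢z (trans x≡b (sym z≡b))

interval-trichotomy : ∀ m n o → n ≤ m ⊎ o ≤ n ⊎ (m < n × n < o)
interval-trichotomy m n o with n ≤? m | o ≤? n
... | yes n≤m | _ = inj₁ n≤m
... | no _ | yes o≤n = inj₂ (inj₁ o≤n)
... | no n≰m | no o≰n = inj₂ (inj₂ (≰⇒> n≰m , ≰⇒> o≰n))

another : ∀ {r} → 2 ≤ r → (a : Fin r) → ∃[ b ] b ≢ a
another (s≤s (s≤s _)) a = punchIn a zero , punchInᵢ≢i a zero

all-along-linked : ∀ {A : Set} {R : A → A → Set} {P : A → Set} → (∀ {x y} → P x → R x y → P y) →
                   ∀ {x xs} → P x → Linked R (x ∷ xs) → All P (x ∷ xs)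
all-along-linked step px [-] = px ∷ []
all-along-linked step px (rxy ∷ linked) = px ∷ all-along-linked step (step px rxy) linked

module _ {A : Set} {R : A → A → Set} where

  trail : ∀ {x y} → Star R x y → List A
  trail ε = []
  trail (_◅_ {j = y} _ ρ) = y ∷ trail ρ

  trail-linked : ∀ {x y} (ρ : Star R x y) → Linked R (x ∷ trail ρ)
  trail-linked ε = [-]
  trail-linked (rxy ◅ ρ) = rxy ∷ trail-linked ρ

  trail-◅◅ʳ : ∀ {P : A → Set} {x y z} (ρ : Star R x y) {σ : Star R y z} →
              Any P (y ∷ trail σ) → Any P (x ∷ trail (ρ ◅◅ σ))
  trail-◅◅ʳ ε visited = visited
  trail-◅◅ʳ (_ ◅ ρ) visited = there (trail-◅◅ʳ ρ visited)

HasDistinct : {A : Set} → ℕ → List A → Set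
HasDistinct {A} n T = Σ (Fin n → A) λ f → (∀ {i j} → f i ≡ f j → i ≡ j) × (∀ i → f i ∈ T)

lookup-injective : ∀ {A : Set} {xs : List A} → Unique xs → ∀ {i j} → lookup xs i ≡ lookup xs j → i ≡ j
lookup-injective (_ ∷ _) {zero} {zero} _ = refl
lookup-injective (x∉xs ∷ _) {zero} {suc j} x≡xsⱼ = contradiction x≡xsⱼ (All.lookup x∉xs (∈-lookup j))
lookup-injective (x∉xs ∷ _) {suc i} {zero} xsᵢ≡x = contradiction (sym xsᵢ≡x) (All.lookup x∉xs (∈-lookup i))
lookup-injective (_ ∷ unique) {suc i} {suc j} eq = cong suc (lookup-injective unique eq)

unique⇒hasDistinct : ∀ {A : Set} {n} {xs : List A} → Unique xs → n ≤ length xs → HasDistinct n xs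
unique⇒hasDistinct {xs = xs} unique n≤|xs| =
  (λ i → lookup xs (inject≤ i n≤|xs|)) ,
  (λ {i} {j} eq → inject≤-injective n≤|xs| n≤|xs| i j (lookup-injective unique eq)) ,
  (λ i → ∈-lookup (inject≤ i n≤|xs|))

Replaces : {A : Set} → A → A → List A → List A → Set
Replaces u v T T′ = ∀ x → x ∈ T′ ⇔ ((x ∈ T × x ≢ u) ⊎ x ≡ v)

module _ {A : Set} {u v : A} {T T′ : List A} (T→T′ : Replaces u v T T′) where

  replaces-stay : ∀ {x} → x ∈ T → x ≢ u → x ∈ T′
  replaces-stay {x} x∈T x≢u = Equivalence.from (T→T′ x) (inj₁ (x∈T , x≢u))

  replaces-new : v ∈ T′
  replaces-new = Equivalence.from (T→T′ v) (inj₂ refl)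

  replaces⁻ : ∀ {x} → x ∈ T′ → (x ∈ T × x ≢ u) ⊎ x ≡ v
  replaces⁻ {x} = Equivalence.to (T→T′ x)

  replaces-hasDistinct : DecidableEquality A → v ∉ T → ∀ {n} → HasDistinct n T → HasDistinct n T′
  replaces-hasDistinct _≟_ v∉T (f , f-injective , f∈T) =
    redirect ∘ f ,
    (λ {i} {j} eq → f-injective (redirect-injective (f∈T i) (f∈T j) eq)) ,
    (λ i → redirect-∈ (f∈T i))
    where
    redirect : A → A
    redirect x with x ≟ u
    ... | yes _ = v
    ... | no _ = x

    redirect-∈ : ∀ {x} → x ∈ T → redirect x ∈ T′
    redirect-∈ {x} x∈T with x ≟ u
    ... | yes _ = replaces-new
    ... | no x≢u = replaces-stay x∈T x≢u

    redirect-injective : ∀ {x y} → x ∈ T → y ∈ T → redirect x ≡ redirect y → x ≡ y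
    redirect-injective {x} {y} x∈T y∈T eq with x ≟ u | y ≟ u
    ... | yes x≡u | yes y≡u = trans x≡u (sym y≡u)
    ... | yes _ | no _ = contradiction (subst (_∈ T) (sym eq) y∈T) v∉T
    ... | no _ | yes _ = contradiction (subst (_∈ T) eq x∈T) v∉T
    ... | no _ | no _ = eq

module _ {G : Graph} where
  open Graph G

  mobile-by-round-trips : ∀ {S} (vs : List V) → (∀ v → v ∈ vs) → IsGP G S →
    (∀ v → ∃[ T ] v ∈ T × Star (LegalMove G) S T × Star (LegalMove G) T S) → IsMobileGP G S
  mobile-by-round-trips {S} vs complete gp round-trip =
    let tour , visits = tour-through vs
    in gp , trail tour , trail-linked tour , λ v → All.lookup visits (complete v)
    where
    tour-through : ∀ vs → Σ (Star (LegalMove G) S S) λ ρ → All (λ v → Any (v ∈_) (S ∷ trail ρ)) vs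
    tour-through [] = ε , []
    tour-through (v ∷ vs) with round-trip v | tour-through vs
    ... | T , v∈T , go , back | ρ , visited =
      go ◅◅ (back ◅◅ ρ) ,
      trail-◅◅ʳ go (here v∈T) ∷ All.map (trail-◅◅ʳ go ∘ trail-◅◅ʳ back) visited

module K□P (r s : ℕ) where

  G : Graph
  G = K r □ P s

  Vertex : Set
  Vertex = Fin r × Fin s

  open IsDistance (□-isDistance (K-isDistance r) (P-isDistance s))

  heights-≢ : ∀ {a b : Fin r} {j k : Fin s} → toℕ j ≢ toℕ k → (a , j) ≢ (b , k)
  heights-≢ j≢k = j≢k ∘ cong toℕ ∘ ,-injectiveʳ

  columns-≢ : ∀ {a b : Fin r} {j k : Fin s} → a ≢ b → (a , j) ≢ (b , k)
  columns-≢ a≢b = a≢b ∘ ,-injectiveˡ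

  collinear : ∀ {a b c j k l} → Between dK a b c → toℕ j ≤ toℕ k → toℕ k ≤ toℕ l →
              OnCommonGeodesic G (a , j) (b , k) (c , l)
  collinear {a} {b} {c} {j} {k} {l} abc j≤k k≤l =
    between⇒onCommonGeodesic (between-⊗ {d₁ = dK} {d₂ = dP} {a , j} {b , k} {c , l} abc (P-between j≤k k≤l))

  onShortest⇒column : ∀ {u w x n} {γ : Walk G u w n} → IsShortest G γ → OnWalk G x γ →
                      proj₁ x ≡ proj₁ u ⊎ proj₁ x ≡ proj₁ w
  onShortest⇒column {u} {w} {x} shortest x∈γ =
    K-between⇒endpoint (between-proj₁ {d₁ = dK} {d₂ = dP} (IsDistance.triangle (P-isDistance s))
                         {u} {x} {w} (onShortest⇒between shortest x∈γ))

  distinct-columns⇒¬onCommonGeodesic : ∀ {x y z : Vertex} →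
    proj₁ x ≢ proj₁ y → proj₁ y ≢ proj₁ z → proj₁ x ≢ proj₁ z → ¬ OnCommonGeodesic G x y z
  distinct-columns⇒¬onCommonGeodesic x≢y y≢z x≢z (_ , _ , _ , _ , shortest , x∈γ , y∈γ , z∈γ) =
    three-distinct-among-two (onShortest⇒column shortest x∈γ) (onShortest⇒column shortest y∈γ)
                             (onShortest⇒column shortest z∈γ) x≢y y≢z x≢z

  transversal : (Fin r → Fin s) → List Vertex
  transversal F = tabulate (λ i → i , F i)

  ∈-transversal⁺ : ∀ {F k t} → t ≡ F k → (k , t) ∈ transversal F
  ∈-transversal⁺ {F} {k} refl = ∈-tabulate⁺ {f = λ i → i , F i} k

  ∈-transversal⁻ : ∀ {F k t} → (k , t) ∈ transversal F → t ≡ F k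
  ∈-transversal⁻ {F} kt∈ with ∈-tabulate⁻ kt∈
  ... | _ , refl = refl

  transversal-unique : ∀ F → Unique (transversal F)
  transversal-unique F = Unique.tabulate⁺ ,-injectiveˡ

  transversal-length : ∀ F → length (transversal F) ≡ r
  transversal-length F = length-tabulate _

  transversal-isGP : ∀ F → IsGP G (transversal F)
  transversal-isGP F x y z x∈ y∈ z∈ x≢y y≢z x≢z =
    distinct-columns⇒¬onCommonGeodesic
      (columns-differ x∈ y∈ x≢y) (columns-differ y∈ z∈ y≢z) (columns-differ x∈ z∈ x≢z)
    where
    columns-differ : ∀ {x y} → x ∈ transversal F → y ∈ transversal F → x ≢ y → proj₁ x ≢ proj₁ y
    columns-differ {k , _} x∈ y∈ x≢y refl =
      x≢y (cong (k ,_) (trans (∈-transversal⁻ x∈) (sym (∈-transversal⁻ y∈))))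

  transversal-move : ∀ {F F′ : Fin r → Fin s} i {h h′} → F i ≡ h → F′ i ≡ h′ → Graph.E (P s) h h′ →
    (∀ k → k ≢ i → F k ≡ F′ k) → LegalMove G (transversal F) (transversal F′)
  transversal-move {F} {F′} i {h} {h′} Fi≡h F′i≡h′ e agree =
    (i , h) , (i , h′) , inj₂ (refl , e) , ∈-transversal⁺ (sym Fi≡h) , ih′∉ , replaces , transversal-isGP F′
    where
    ih′∉ : (i , h′) ∉ transversal F
    ih′∉ ih′∈ = P-edge⇒≢ e (trans (sym Fi≡h) (sym (∈-transversal⁻ ih′∈)))

    replaces : Replaces (i , h) (i , h′) (transversal F) (transversal F′)
    replaces (k , t) with k Fin.≟ i
    ... | yes refl = mk⇔
      (λ kt∈ → inj₂ (cong (k ,_) (trans (∈-transversal⁻ kt∈) F′i≡h′)))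
      λ { (inj₁ (kt∈ , kt≢kh)) → contradiction (cong (k ,_) (trans (∈-transversal⁻ kt∈) Fi≡h)) kt≢kh
        ; (inj₂ refl) → ∈-transversal⁺ (sym F′i≡h′) }
    ... | no k≢i = mk⇔
      (λ kt∈ → inj₁ (∈-transversal⁺ (trans (∈-transversal⁻ kt∈) (sym (agree k k≢i))) , columns-≢ k≢i))
      λ { (inj₁ (kt∈ , _)) → ∈-transversal⁺ (trans (∈-transversal⁻ kt∈) (agree k k≢i))
        ; (inj₂ kt≡ih′) → contradiction (,-injectiveˡ kt≡ih′) k≢i }

  follow : ∀ i {h h′ n} → Walk (P s) h h′ n → ∀ {F F′} → F i ≡ h → F′ i ≡ h′ →
           (∀ k → k ≢ i → F k ≡ F′ k) → Star (LegalMove G) (transversal F) (transversal F′)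
  follow i [] {F} {F′} refl F′i≡h agree =
    subst (Star _ (transversal F)) (tabulate-cong (λ k → cong (k ,_) (F≗F′ k))) ε
    where
    F≗F′ : ∀ k → F k ≡ F′ k
    F≗F′ k with k Fin.≟ i
    ... | yes refl = sym F′i≡h
    ... | no k≢i = agree k k≢i
  follow i (_∷_ {b = b} e w) {F} Fi≡h F′i≡h′ agree =
    transversal-move i Fi≡h (updateAt-updates i F) e (λ k k≢i → sym (updateAt-minimal k i F k≢i)) ◅
    follow i w {F = F₁} (updateAt-updates i F) F′i≡h′
      (λ k k≢i → trans (updateAt-minimal k i F k≢i) (agree k k≢i))
    where
    F₁ : Fin r → Fin s
    F₁ = updateAt F i (const b)

  transversal-mobile : ∀ F → IsMobileGP G (transversal F)
  transversal-mobile F = mobile-by-round-trips (cartesianProduct (allFin r) (allFin s))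
    (λ (i , h) → ∈-cartesianProduct⁺ (∈-allFin i) (∈-allFin h)) (transversal-isGP F) round-trip
    where
    round-trip : ∀ v → ∃[ T ] v ∈ T × Star (LegalMove G) (transversal F) T ×
                                      Star (LegalMove G) T (transversal F)
    round-trip (i , h) =
      transversal F′ , ∈-transversal⁺ (sym (updateAt-updates i F)) ,
      follow i (P-geodesic (F i) h) refl (updateAt-updates i F)
        (λ k k≢i → sym (updateAt-minimal k i F k≢i)) ,
      follow i (P-geodesic h (F i)) (updateAt-updates i F) refl (λ k k≢i → updateAt-minimal k i F k≢i)
      where
      F′ : Fin r → Fin s
      F′ = updateAt F i (const h)

  Doubled : Fin r → List Vertex → Set
  Doubled c T = ∃[ p ] ∃[ q ] toℕ p < toℕ q × (c , p) ∈ T × (c , q) ∈ T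

  doubled : ∀ {c p q T} → toℕ p ≢ toℕ q → (c , p) ∈ T → (c , q) ∈ T → Doubled c T
  doubled {p = p} {q} p≢q cp∈T cq∈T with <-cmp (toℕ p) (toℕ q)
  ... | tri< p<q _ _ = p , q , p<q , cp∈T , cq∈T
  ... | tri≈ _ p≡q _ = contradiction p≡q p≢q
  ... | tri> _ _ q<p = q , p , q<p , cq∈T , cp∈T

  doubled-other-than : ∀ {a T} → Doubled a T → ∀ k → ∃[ m ] (a , m) ∈ T × (a , m) ≢ (a , k)
  doubled-other-than (p , q , p<q , ap∈T , aq∈T) k with k Fin.≟ p
  ... | yes refl = q , aq∈T , heights-≢ (<⇒≢ p<q ∘ sym)
  ... | no k≢p = p , ap∈T , k≢p ∘ sym ∘ ,-injectiveʳ

  module _ {T : List Vertex} (gp : IsGP G T) where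

    others-strictly-between : ∀ {c p q b t} → toℕ p < toℕ q → (c , p) ∈ T → (c , q) ∈ T →
      (b , t) ∈ T → (b , t) ≢ (c , p) → (b , t) ≢ (c , q) → b ≢ c × toℕ p < toℕ t × toℕ t < toℕ q
    others-strictly-between {c} {p} {q} {b} {t} p<q cp cq bt bt≢cp bt≢cq
      with interval-trichotomy (toℕ p) (toℕ t) (toℕ q)
    ... | inj₁ t≤p = ⊥-elim (gp _ _ _ bt cp cq bt≢cp (heights-≢ (<⇒≢ p<q)) bt≢cq
            (collinear (K-between-right b c) t≤p (<⇒≤ p<q)))
    ... | inj₂ (inj₁ q≤t) = ⊥-elim (gp _ _ _ cp cq bt (heights-≢ (<⇒≢ p<q)) (bt≢cq ∘ sym) (bt≢cp ∘ sym)
            (collinear (K-between-left c b) (<⇒≤ p<q) q≤t))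
    ... | inj₂ (inj₂ (p<t , t<q)) with b Fin.≟ c
    ...   | no b≢c = b≢c , p<t , t<q
    ...   | yes refl = ⊥-elim (gp _ _ _ cp bt cq (bt≢cp ∘ sym) bt≢cq (heights-≢ (<⇒≢ p<q))
            (collinear (K-between-left b b) (<⇒≤ p<t) (<⇒≤ t<q)))

    doubled-unique : ∀ {a c} → Doubled a T → Doubled c T → c ≡ a
    doubled-unique {a} {c} (p , q , p<q , ap , aq) (p′ , q′ , p′<q′ , cp′ , cq′) with c Fin.≟ a
    ... | yes c≡a = c≡a
    ... | no c≢a
      with others-strictly-between p<q ap aq cp′ (columns-≢ c≢a) (columns-≢ c≢a)
         | others-strictly-between p′<q′ cp′ cq′ ap (columns-≢ (c≢a ∘ sym)) (columns-≢ (c≢a ∘ sym))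
    ...   | _ , p<p′ , _ | _ , p′<p , _ = ⊥-elim (<-asym p<p′ p′<p)

    doubled-only-two : ∀ {a p q k} → toℕ p < toℕ q → (a , p) ∈ T → (a , q) ∈ T → (a , k) ∈ T →
                       k ≡ p ⊎ k ≡ q
    doubled-only-two {p = p} {q} {k} p<q ap aq ak with k Fin.≟ p | k Fin.≟ q
    ... | yes k≡p | _ = inj₁ k≡p
    ... | no _ | yes k≡q = inj₂ k≡q
    ... | no k≢p | no k≢q =
      contradiction refl
        (proj₁ (others-strictly-between p<q ap aq ak (k≢p ∘ ,-injectiveʳ) (k≢q ∘ ,-injectiveʳ)))

  hasDistinct⇒doubled : ∀ {T} → HasDistinct (suc r) T → ∃[ c ] Doubled c T
  hasDistinct⇒doubled {T} (f , f-injective , f∈T) with pigeonhole (n<1+n r) (proj₁ ∘ f)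
  ... | i , j , i<j , same-column =
    proj₁ (f i) ,
    doubled heights-differ (f∈T i) (subst (λ c → (c , proj₂ (f j)) ∈ T) (sym same-column) (f∈T j))
    where
    heights-differ : toℕ (proj₂ (f i)) ≢ toℕ (proj₂ (f j))
    heights-differ eq = Fin.<⇒≢ i<j (f-injective (cong₂ _,_ same-column (toℕ-injective eq)))

  module _ {a c′ k T T′} (gp : IsGP G T) (distinct′ : HasDistinct (suc r) T′) (dbl : Doubled a T)
           (ak∈T : (a , k) ∈ T) (c′≢a : c′ ≢ a) (T→T′ : Replaces (a , k) (c′ , k) T T′) where

    -- T′ has a doubled column.  It is not a (column a of T would hold three robots) nor a column
    -- already doubled in T (only a is), so the moved robot doubles column c′ with an old robot.
    horizontal-exit-partner : ∃[ m ] toℕ m ≢ toℕ k × (c′ , m) ∈ T × (c′ , m) ∈ T′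
    horizontal-exit-partner with hasDistinct⇒doubled distinct′
    ... | c″ , p′ , q′ , p′<q′ , c″p′∈T′ , c″q′∈T′ with replaces⁻ T→T′ c″p′∈T′ | replaces⁻ T→T′ c″q′∈T′
    ...   | inj₂ refl | inj₁ (c′q′∈T , _) = q′ , <⇒≢ p′<q′ ∘ sym , c′q′∈T , c″q′∈T′
    ...   | inj₁ (c′p′∈T , _) | inj₂ refl = p′ , <⇒≢ p′<q′ , c′p′∈T , c″p′∈T′
    ...   | inj₂ refl | inj₂ eq = contradiction (cong toℕ (,-injectiveʳ eq)) (<⇒≢ p′<q′ ∘ sym)
    ...   | inj₁ (c″p′∈T , c″p′≢ak) | inj₁ (c″q′∈T , c″q′≢ak)
      with doubled-unique gp dbl (p′ , q′ , p′<q′ , c″p′∈T , c″q′∈T)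
    ...     | refl = contradiction refl (proj₁
                       (others-strictly-between gp p′<q′ c″p′∈T c″q′∈T ak∈T (c″p′≢ak ∘ sym) (c″q′≢ak ∘ sym)))

  no-horizontal-exit : ∀ {a c′ k T T′} → IsGP G T → IsGP G T′ → HasDistinct (suc r) T′ → Doubled a T →
    (a , k) ∈ T → c′ ≢ a → Replaces (a , k) (c′ , k) T T′ → ⊥
  -- In T the partner m lies strictly between p and q; in T′ the robot left in column a must lie
  -- strictly between k and m, although k is p or q.
  no-horizontal-exit gp gp′ distinct′ dbl@(p , q , p<q , ap∈T , aq∈T) ak∈T c′≢a T→T′
    with horizontal-exit-partner gp distinct′ dbl ak∈T c′≢a T→T′
  ... | m , _ , c′m∈T , c′m∈T′
    with others-strictly-between gp p<q ap∈T aq∈T c′m∈T (columns-≢ c′≢a) (columns-≢ c′≢a)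
       | doubled-only-two gp p<q ap∈T aq∈T ak∈T
  ...   | _ , p<m , m<q | inj₁ refl =
    <-asym m<q (proj₂ (proj₂ (others-strictly-between gp′ p<m (replaces-new T→T′) c′m∈T′
      (replaces-stay T→T′ aq∈T (heights-≢ (<⇒≢ p<q ∘ sym)))
      (columns-≢ (c′≢a ∘ sym)) (columns-≢ (c′≢a ∘ sym)))))
  ...   | _ , p<m , m<q | inj₂ refl =
    <-asym p<m (proj₁ (proj₂ (others-strictly-between gp′ m<q c′m∈T′ (replaces-new T→T′)
      (replaces-stay T→T′ ap∈T (heights-≢ (<⇒≢ p<q)))
      (columns-≢ (c′≢a ∘ sym)) (columns-≢ (c′≢a ∘ sym)))))

  doubled-preserved : ∀ {a c k c′ k′ T T′} → IsGP G T → IsGP G T′ → HasDistinct (suc r) T′ →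
    Doubled a T → Graph.E G (c , k) (c′ , k′) → (c , k) ∈ T → (c′ , k′) ∉ T →
    Replaces (c , k) (c′ , k′) T T′ → Doubled a T′
  doubled-preserved {a} {c} {k} {T = T} gp gp′ distinct′ dbl@(p , q , p<q , ap∈T , aq∈T)
                    e ck∈T c′k′∉T T→T′
    with c Fin.≟ a
  ... | no c≢a = p , q , p<q , replaces-stay T→T′ ap∈T (columns-≢ (c≢a ∘ sym))
                             , replaces-stay T→T′ aq∈T (columns-≢ (c≢a ∘ sym))
  ... | yes refl with e
  ...   | inj₁ (a≢c′ , refl) = ⊥-elim (no-horizontal-exit gp gp′ distinct′ dbl ck∈T (a≢c′ ∘ sym) T→T′)
  ...   | inj₂ (refl , _) with doubled-other-than dbl k
  ...     | m , am∈T , am≢ak =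
    doubled (λ m≡k′ → c′k′∉T (subst (λ t → (a , t) ∈ T) (toℕ-injective m≡k′) am∈T))
            (replaces-stay T→T′ am∈T am≢ak) (replaces-new T→T′)

  Invariant : Fin r → List Vertex → Set
  Invariant a T = IsGP G T × HasDistinct (suc r) T × Doubled a T

  invariant-preserved : ∀ {a T T′} → Invariant a T → LegalMove G T T′ → Invariant a T′
  invariant-preserved (gp , distinct , dbl) (_ , _ , e , u∈T , v∉T , T→T′ , gp′) =
    gp′ , distinct′ , doubled-preserved gp gp′ distinct′ dbl e u∈T v∉T T→T′
    where
    distinct′ : HasDistinct (suc r) _
    distinct′ = replaces-hasDistinct T→T′ (≡-dec Fin._≟_ Fin._≟_) v∉T distinct

  above-floor : ∀ {a b t T} → Invariant a T → b ≢ a → (b , t) ∈ T → 0 < toℕ t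
  above-floor (gp , _ , p , q , p<q , ap∈T , aq∈T) b≢a bt∈T =
    ≤-<-trans z≤n
      (proj₁ (proj₂ (others-strictly-between gp p<q ap∈T aq∈T bt∈T (columns-≢ b≢a) (columns-≢ b≢a))))

  more-than-r⇒¬mobile : 2 ≤ r → 0 < s → ∀ {S} → HasDistinct (suc r) S → ¬ IsMobileGP G S
  more-than-r⇒¬mobile 2≤r 0<s {S} distinct (gp , rest , linked , covers) =
    let inv , b∈T = All.lookupAny invariants (covers (b , floor))
    in <-irrefl (sym (toℕ-fromℕ< 0<s)) (above-floor inv b≢a b∈T)
    where
    a : Fin r
    a = proj₁ (hasDistinct⇒doubled distinct)

    invariants : All (Invariant a) (S ∷ rest)
    invariants =
      all-along-linked invariant-preserved (gp , distinct , proj₂ (hasDistinct⇒doubled distinct)) linked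

    b : Fin r
    b = proj₁ (another 2≤r a)

    b≢a : b ≢ a
    b≢a = proj₂ (another 2≤r a)

    floor : Fin s
    floor = fromℕ< 0<s

  mobile⇒length≤r : 2 ≤ r → 0 < s → ∀ S → Unique S → IsMobileGP G S → length S ≤ r
  mobile⇒length≤r 2≤r 0<s S unique mobile with length S ≤? r
  ... | yes |S|≤r = |S|≤r
  ... | no |S|≰r =
    contradiction mobile (more-than-r⇒¬mobile 2≤r 0<s (unique⇒hasDistinct unique (≰⇒> |S|≰r)))

proposition2p2 : ∀ (r s : ℕ) → 2 ≤ r → 2 ≤ s → MobEq (K r □ P s) r
proposition2p2 r s 2≤r 2≤s =
  (transversal bottom , transversal-unique bottom , transversal-mobile bottom , transversal-length bottom) ,
  mobile⇒length≤r 2≤r 0<s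
  where
  open K□P r s

  0<s : 0 < s
  0<s = ≤-trans (s≤s z≤n) 2≤s

  bottom : Fin r → Fin s
  bottom _ = fromℕ< 0<s
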